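{- Let $n\ge1$ and let $s$ be an integer with $n/2<s\le n$. Among the pairs in $\mathcal A_s$ there exists one of maximum cardinality such that every tuple in $T'\cup T''$ has at least $\lfloor n/2\rfloor$ components equal to $1$.
   Context: $\{0,1\}^n$ is ordered componentwise; an antichain is a set of pairwise incomparable tuples. $\tilde\gamma_s$ is the tuple of $n-s$ zeros followed by $s$ ones. $\mathcal A_s$ is the set of pairs $(T',T'')$ of antichains in $\{0,1\}^n$ such that $\tilde\gamma_s\in T'$ and there are no $\tilde\alpha'\in T'$, $\tilde\alpha''\in T''$ with $\tilde\alpha'\ge\tilde\alpha''$ (so $T'\cap T''=\emptyset$). The cardinality of such a pair is $|T'|+|T''|$. -}

module Defs where

open import Data.Bool using (Bool; true; false)
open import Data.Nat using (ℕ; _+_; _∸_; _≤_; _≤?_)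
open import Data.Fin using (Fin; toℕ)
open import Data.Vec using (Vec; lookup; tabulate; count)
open import Data.List using (List; length)
open import Data.List.Membership.Propositional using (_∈_)
open import Data.List.Relation.Unary.All using (All)
open import Data.List.Relation.Unary.Unique.Propositional using (Unique)
open import Data.Product using (_×_)
open import Relation.Binary.PropositionalEquality using (_≡_)
open import Relation.Nullary using (¬_; does)
open import Data.Bool.Properties using (T?)

-- Boolean tuples of length n, i.e. elements of {0,1}^n (false = 0, true = 1).
Tuple : ℕ → Set
Tuple n = Vec Bool n

_≼_ : ∀ {n} → Tuple n → Tuple n → Set
α ≼ β = ∀ i → lookup α i ≡ true → lookup β i ≡ true

ones : ∀ {n} → Tuple n → ℕ
ones α = count T? α

-- a finite set of tuples is a duplicate-free list; its cardinality is its length.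
-- An antichain: a set of pairwise incomparable tuples.
IsAntichain : ∀ {n} → List (Tuple n) → Set
IsAntichain {n} T =
  Unique T × (∀ α β → α ∈ T → β ∈ T → α ≼ β → α ≡ β)

-- γ̃_s : n - s zeros followed by s ones (for s ≤ n):
-- component i (0-based) is 1 iff n - s ≤ i
gamma : (n s : ℕ) → Tuple n
gamma n s = tabulate (λ i → does (n ∸ s ≤? toℕ i))

-- membership in 𝒜_s, with γ̃_s given as a tuple g of length n
InA : ∀ {n} → Tuple n → List (Tuple n) → List (Tuple n) → Set
InA g T′ T″ =
  IsAntichain T′ × IsAntichain T″ × g ∈ T′ ×
  (∀ α′ α″ → α′ ∈ T′ → α″ ∈ T″ → ¬ (α″ ≼ α′))

card : ∀ {n} → List (Tuple n) → List (Tuple n) → ℕ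
card T′ T″ = length T′ + length T″

module Submission where

-- Identify a pair (T′, T″) ∈ 𝒜_s with a single antichain of the cube {0,1}^(n+1):
-- put 1a for a ∈ T′ and 0a for a ∈ T″.  This is an antichain containing 1γ̃_s exactly
-- because T′, T″ are antichains and no member of T′ lies above one of T″, and it has
-- |T′| + |T″| elements.  So lemma6 asks for a largest antichain of {0,1}^(n+1) through
-- x = 1γ̃_s all of whose members have weight ≥ ⌊n/2⌋ + 1.
--
-- Double counting the covering pairs a ⋖ b
-- gives the shadow inequality: a family of k-element tuples with 2k+1 ≤ N has an upper
-- shadow at least as large.  Replacing the lowest level k of an antichain by its upper
-- shadow therefore yields an antichain that is no smaller, lives on levels ≥ k+1 and
-- keeps all members above level k; iterating this raises any antichain to level ⌊n/2⌋+1.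
-- A largest antichain through x exists since there are finitely many families, and
-- raising it keeps x (of weight s+1) and maximality.  Reading the result back as a pair
-- gives the theorem.

open import Defs
open import Data.Nat using (ℕ; _≤_; _<_; _*_; _/_)
open import Data.Product using (Σ; _×_)
open import Data.List using (List)
open import Data.List.Membership.Propositional using (_∈_)

open import Data.Bool using (Bool; true; false; _∧_; _∨_; not; if_then_else_)
open import Data.Bool.Properties using (∧-conicalˡ; ∧-conicalʳ; not-injective) renaming (_≟_ to _≟ᵇ_)
open import Data.Nat using (zero; suc; _+_; _∸_; z≤n; s≤s; s≤s⁻¹; _≟_; _≤?_)
open import Data.Nat.Properties
open import Algebra.Properties.CommutativeSemigroup +-commutativeSemigroup using (interchange)
open import Data.Nat.DivMod using (m<n*o⇒m/o<n; m/n*n≤m)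
open import Data.Fin using (Fin; toℕ) renaming (zero to fzero; suc to fsuc)
open import Data.Fin.Properties using (all?)
open import Data.Vec using ([]; _∷_; lookup; tabulate)
open import Data.Vec.Properties using (≡-dec; ∷-injectiveʳ)
open import Data.List using ([]; _∷_; _++_; map; length; filter; cartesianProductWith)
open import Data.List.Properties using (length-++; length-map)
open import Data.List.Membership.Propositional.Properties
  using (∈-++⁺ˡ; ∈-++⁺ʳ; ∈-++⁻; ∈-map⁺; ∈-map⁻; ∈-filter⁺; ∈-cartesianProductWith⁺)
import Data.List.Membership.DecPropositional as DecMembership
open import Data.List.Relation.Unary.Any using (here; there)
import Data.List.Relation.Unary.All as All
open import Data.List.Relation.Unary.All.Properties using (all-filter)
import Data.List.Relation.Unary.AllPairs as AllPairs
open import Data.List.Relation.Unary.Unique.Propositional using (Unique)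
import Data.List.Relation.Unary.Unique.Propositional.Properties as Unique
open import Data.List.Extrema.Nat using (argmax; argmax-all; f[xs]≤f[argmax])
open import Data.Product using (_,_; proj₁; proj₂; ∃-syntax)
open import Data.Sum using (_⊎_; inj₁; inj₂)
open import Data.Empty using (⊥; ⊥-elim)
open import Function using (id; _∘_)
open import Relation.Binary.PropositionalEquality
open import Relation.Nullary using (Dec; yes; no; does; ¬_; contradiction; map′; _×-dec_; _⊎-dec_; _→-dec_)
open import Relation.Nullary.Decidable using (dec-true; dec-false; does-⇔)
open import Function.Bundles using (mk⇔)

does-true : {A : Set} (d : Dec A) → does d ≡ true → A
does-true (yes a) _ = a
does-true (no _) ()

does-false : {A : Set} (d : Dec A) → does d ≡ false → ¬ A
does-false (no ¬a) _ = ¬a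
does-false (yes _) ()

∨-split : ∀ x y → x ∨ y ≡ true → x ≡ true ⊎ y ≡ true
∨-split true y _ = inj₁ refl
∨-split false y e = inj₂ e

_≟ᵗ_ : ∀ {N} (a b : Tuple N) → Dec (a ≡ b)
_≟ᵗ_ = ≡-dec _≟ᵇ_

≟ᵗ-sym : ∀ {N} (a b : Tuple N) → does (a ≟ᵗ b) ≡ does (b ≟ᵗ a)
≟ᵗ-sym a b = does-⇔ (mk⇔ sym sym) (a ≟ᵗ b) (b ≟ᵗ a)

∀-cube? : ∀ {N} {P : Tuple N → Set} → (∀ a → Dec (P a)) → Dec (∀ a → P a)
∀-cube? {zero} P? = map′ (λ p → λ { [] → p }) (λ h → h []) (P? [])
∀-cube? {suc N} P? =
  map′ (λ (h₀ , h₁) → λ { (false ∷ a) → h₀ a ; (true ∷ a) → h₁ a })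
       (λ h → (λ a → h (false ∷ a)) , (λ a → h (true ∷ a)))
       (∀-cube? (λ a → P? (false ∷ a)) ×-dec ∀-cube? (λ a → P? (true ∷ a)))

∃-cube? : ∀ {N} {P : Tuple N → Set} → (∀ a → Dec (P a)) → Dec (∃[ a ] P a)
∃-cube? {zero} P? = map′ ([] ,_) (λ { ([] , p) → p }) (P? [])
∃-cube? {suc N} P? =
  map′ (λ { (inj₁ (a , p)) → false ∷ a , p ; (inj₂ (a , p)) → true ∷ a , p })
       (λ { (false ∷ a , p) → inj₁ (a , p) ; (true ∷ a , p) → inj₂ (a , p) })
       (∃-cube? (λ a → P? (false ∷ a)) ⊎-dec ∃-cube? (λ a → P? (true ∷ a)))

face : ∀ {N} {A : Set} → Bool → (Tuple (suc N) → A) → Tuple N → A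
face x f a = f (x ∷ a)

∑ : ∀ {N} → (Tuple N → ℕ) → ℕ
∑ {zero} f = f []
∑ {suc N} f = ∑ (face false f) + ∑ (face true f)

ind : Bool → ℕ
ind false = 0
ind true = 1

Family : ℕ → Set
Family N = Tuple N → Bool

# : ∀ {N} → Family N → ℕ
# p = ∑ (λ a → ind (p a))

∑-cong : ∀ {N} {f g : Tuple N → ℕ} → (∀ a → f a ≡ g a) → ∑ f ≡ ∑ g
∑-cong {zero} f≗g = f≗g []
∑-cong {suc N} f≗g = cong₂ _+_ (∑-cong (λ a → f≗g (false ∷ a))) (∑-cong (λ a → f≗g (true ∷ a)))

∑-mono : ∀ {N} {f g : Tuple N → ℕ} → (∀ a → f a ≤ g a) → ∑ f ≤ ∑ g
∑-mono {zero} f≤g = f≤g []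
∑-mono {suc N} f≤g = +-mono-≤ (∑-mono (λ a → f≤g (false ∷ a))) (∑-mono (λ a → f≤g (true ∷ a)))

∑-+ : ∀ {N} (f g : Tuple N → ℕ) → ∑ (λ a → f a + g a) ≡ ∑ f + ∑ g
∑-+ {zero} f g = refl
∑-+ {suc N} f g =
  trans (cong₂ _+_ (∑-+ (face false f) (face false g)) (∑-+ (face true f) (face true g)))
        (interchange (∑ (face false f)) (∑ (face false g)) (∑ (face true f)) (∑ (face true g)))

∑-*ʳ : ∀ {N} (f : Tuple N → ℕ) m → ∑ (λ a → f a * m) ≡ ∑ f * m
∑-*ʳ {zero} f m = refl
∑-*ʳ {suc N} f m =
  trans (cong₂ _+_ (∑-*ʳ (face false f) m) (∑-*ʳ (face true f) m))
        (sym (*-distribʳ-+ m (∑ (face false f)) (∑ (face true f))))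

∑-swap : ∀ {M N} (h : Tuple M → Tuple N → ℕ) →
  ∑ (λ a → ∑ (λ b → h a b)) ≡ ∑ (λ b → ∑ (λ a → h a b))
∑-swap {zero} h = refl
∑-swap {suc M} h =
  trans (cong₂ _+_ (∑-swap (face false h)) (∑-swap (face true h)))
        (sym (∑-+ (λ b → ∑ (λ a → h (false ∷ a) b)) (λ b → ∑ (λ a → h (true ∷ a) b))))

#-cong : ∀ {N} {p q : Family N} → (∀ a → p a ≡ q a) → # p ≡ # q
#-cong p≗q = ∑-cong (λ a → cong ind (p≗q a))

#-empty : ∀ {N} (p : Family N) → (∀ a → p a ≡ false) → # p ≡ 0
#-empty {zero} p none rewrite none [] = refl
#-empty {suc N} p none =
  cong₂ _+_ (#-empty (face false p) (λ a → none (false ∷ a)))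
            (#-empty (face true p) (λ a → none (true ∷ a)))

#-∅ : ∀ N → # {N} (λ _ → false) ≡ 0
#-∅ N = #-empty {N} (λ _ → false) (λ _ → refl)

#-mono : ∀ {N} {p q : Family N} → (∀ a → p a ≡ true → q a ≡ true) → # p ≤ # q
#-mono p⊆q = ∑-mono (λ a → ind-mono (p⊆q a))
  where
  ind-mono : ∀ {x y} → (x ≡ true → y ≡ true) → ind x ≤ ind y
  ind-mono {false} _ = z≤n
  ind-mono {true} x⇒y rewrite x⇒y refl = ≤-refl

#-split : ∀ {N} (p c : Family N) → # p ≡ # (λ a → p a ∧ not (c a)) + # (λ a → p a ∧ c a)
#-split p c = trans (∑-cong (λ a → split (p a) (c a)))
                    (∑-+ (λ a → ind (p a ∧ not (c a))) (λ a → ind (p a ∧ c a)))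
  where
  split : ∀ x y → ind x ≡ ind (x ∧ not y) + ind (x ∧ y)
  split false y = refl
  split true false = refl
  split true true = refl

#-∨ : ∀ {N} (p q : Family N) → (∀ a → p a ≡ true → q a ≡ true → ⊥) →
  # (λ a → p a ∨ q a) ≡ # p + # q
#-∨ p q disjoint = trans (∑-cong (λ a → union (p a) (q a) (disjoint a)))
                         (∑-+ (λ a → ind (p a)) (λ a → ind (q a)))
  where
  union : ∀ x y → (x ≡ true → y ≡ true → ⊥) → ind (x ∨ y) ≡ ind x + ind y
  union false y _ = refl
  union true false _ = refl
  union true true d = ⊥-elim (d refl refl)

#-singleton : ∀ {N} (b : Tuple N) → # (λ a → does (a ≟ᵗ b)) ≡ 1
#-singleton [] = refl
#-singleton {suc N} (false ∷ b) = cong₂ _+_ (#-singleton b) (#-∅ N)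
#-singleton {suc N} (true ∷ b) = cong₂ _+_ (#-∅ N) (#-singleton b)

#-singletonʳ : ∀ {N} (a : Tuple N) → # (λ b → does (a ≟ᵗ b)) ≡ 1
#-singletonʳ a = trans (#-cong (λ b → ≟ᵗ-sym a b)) (#-singleton a)

-- The componentwise order, inductively: the first components satisfy x ≤ y and the
-- tails are ordered.  It agrees with ≼ and is easier to compute with.
data _⊑_ : ∀ {N} → Tuple N → Tuple N → Set where
  done : [] ⊑ []
  stay : ∀ {N} x {a b : Tuple N} → a ⊑ b → (x ∷ a) ⊑ (x ∷ b)
  rise : ∀ {N} {a b : Tuple N} → a ⊑ b → (false ∷ a) ⊑ (true ∷ b)

⊑⇒≼ : ∀ {N} {a b : Tuple N} → a ⊑ b → a ≼ b
⊑⇒≼ (stay x a⊑b) fzero = id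
⊑⇒≼ (stay x a⊑b) (fsuc i) = ⊑⇒≼ a⊑b i
⊑⇒≼ (rise a⊑b) fzero = λ _ → refl
⊑⇒≼ (rise a⊑b) (fsuc i) = ⊑⇒≼ a⊑b i

≼⇒⊑ : ∀ {N} (a b : Tuple N) → a ≼ b → a ⊑ b
≼⇒⊑ [] [] _ = done
≼⇒⊑ (false ∷ a) (false ∷ b) h = stay false (≼⇒⊑ a b (h ∘ fsuc))
≼⇒⊑ (false ∷ a) (true ∷ b) h = rise (≼⇒⊑ a b (h ∘ fsuc))
≼⇒⊑ (true ∷ a) (true ∷ b) h = stay true (≼⇒⊑ a b (h ∘ fsuc))
≼⇒⊑ (true ∷ a) (false ∷ b) h with h fzero refl
... | ()

_⊑?_ : ∀ {N} (a b : Tuple N) → Dec (a ⊑ b)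
a ⊑? b = map′ (≼⇒⊑ a b) ⊑⇒≼ (all? (λ i → (lookup a i ≟ᵇ true) →-dec (lookup b i ≟ᵇ true)))

⊑-refl : ∀ {N} (a : Tuple N) → a ⊑ a
⊑-refl [] = done
⊑-refl (x ∷ a) = stay x (⊑-refl a)

⊑-trans : ∀ {N} {a b c : Tuple N} → a ⊑ b → b ⊑ c → a ⊑ c
⊑-trans done done = done
⊑-trans (stay x a⊑b) (stay .x b⊑c) = stay x (⊑-trans a⊑b b⊑c)
⊑-trans (stay .false a⊑b) (rise b⊑c) = rise (⊑-trans a⊑b b⊑c)
⊑-trans (rise a⊑b) (stay .true b⊑c) = rise (⊑-trans a⊑b b⊑c)

ones-mono : ∀ {N} {a b : Tuple N} → a ⊑ b → ones a ≤ ones b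
ones-mono done = z≤n
ones-mono (stay false a⊑b) = ones-mono a⊑b
ones-mono (stay true a⊑b) = s≤s (ones-mono a⊑b)
ones-mono (rise a⊑b) = m≤n⇒m≤1+n (ones-mono a⊑b)

⊑-ones-eq : ∀ {N} {a b : Tuple N} → a ⊑ b → ones b ≤ ones a → a ≡ b
⊑-ones-eq done _ = refl
⊑-ones-eq (stay false a⊑b) le = cong (false ∷_) (⊑-ones-eq a⊑b le)
⊑-ones-eq (stay true a⊑b) le = cong (true ∷_) (⊑-ones-eq a⊑b (s≤s⁻¹ le))
⊑-ones-eq (rise a⊑b) le = contradiction le (<⇒≱ (s≤s (ones-mono a⊑b)))

_⋖_ : ∀ {N} → Tuple N → Tuple N → Bool
[] ⋖ [] = false
(false ∷ a) ⋖ (false ∷ b) = a ⋖ b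
(false ∷ a) ⋖ (true ∷ b) = does (a ≟ᵗ b)
(true ∷ a) ⋖ (false ∷ b) = false
(true ∷ a) ⋖ (true ∷ b) = a ⋖ b

⋖-⊑ : ∀ {N} (a b : Tuple N) → a ⋖ b ≡ true → a ⊑ b
⋖-⊑ [] [] ()
⋖-⊑ (false ∷ a) (false ∷ b) a⋖b = stay false (⋖-⊑ a b a⋖b)
⋖-⊑ (false ∷ a) (true ∷ b) a≡b rewrite does-true (a ≟ᵗ b) a≡b = rise (⊑-refl b)
⋖-⊑ (true ∷ a) (true ∷ b) a⋖b = stay true (⋖-⊑ a b a⋖b)

⋖-ones : ∀ {N} (a b : Tuple N) → a ⋖ b ≡ true → ones b ≡ suc (ones a)
⋖-ones [] [] ()
⋖-ones (false ∷ a) (false ∷ b) a⋖b = ⋖-ones a b a⋖b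
⋖-ones (false ∷ a) (true ∷ b) a≡b rewrite does-true (a ≟ᵗ b) a≡b = refl
⋖-ones (true ∷ a) (true ∷ b) a⋖b = cong suc (⋖-ones a b a⋖b)

up-degree : ∀ {N} (a : Tuple N) → # (a ⋖_) + ones a ≡ N
up-degree [] = refl
up-degree {suc N} (false ∷ a) = begin
  (# (a ⋖_) + # (λ b → does (a ≟ᵗ b))) + ones a ≡⟨ cong (λ m → (# (a ⋖_) + m) + ones a) (#-singletonʳ a) ⟩
  (# (a ⋖_) + 1) + ones a                      ≡⟨ cong (_+ ones a) (+-comm (# (a ⋖_)) 1) ⟩
  suc (# (a ⋖_) + ones a)                      ≡⟨ cong suc (up-degree a) ⟩
  suc N ∎
  where open ≡-Reasoning
up-degree {suc N} (true ∷ a) = begin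
  (# (λ b → (true ∷ a) ⋖ (false ∷ b)) + # (a ⋖_)) + suc (ones a) ≡⟨ cong (λ m → (m + # (a ⋖_)) + suc (ones a)) (#-∅ N) ⟩
  # (a ⋖_) + suc (ones a)                                          ≡⟨ +-suc (# (a ⋖_)) (ones a) ⟩
  suc (# (a ⋖_) + ones a)                                          ≡⟨ cong suc (up-degree a) ⟩
  suc N ∎
  where open ≡-Reasoning

down-degree : ∀ {N} (b : Tuple N) → # (_⋖ b) ≡ ones b
down-degree [] = refl
down-degree {suc N} (false ∷ b) = trans (cong₂ _+_ (down-degree b) (#-∅ N)) (+-identityʳ (ones b))
down-degree (true ∷ b) = cong₂ _+_ (#-singleton b) (down-degree b)

∇ : ∀ {N} → Family N → Family N
∇ p b = does (∃-cube? (λ a → (p a ∧ a ⋖ b) ≟ᵇ true))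

∇-intro : ∀ {N} (p : Family N) {a b} → p a ≡ true → a ⋖ b ≡ true → ∇ p b ≡ true
∇-intro p {a} pa a⋖b = dec-true (∃-cube? _) (a , cong₂ _∧_ pa a⋖b)

∇-witness : ∀ {N} (p : Family N) {b} → ∇ p b ≡ true → ∃[ a ] p a ≡ true × a ⋖ b ≡ true
∇-witness p ∇pb with does-true (∃-cube? _) ∇pb
... | a , cover = a , ∧-conicalˡ _ _ cover , ∧-conicalʳ _ _ cover

-- Count the
-- covering pairs a ⋖ b with a ∈ p: each a ∈ p lies in N ∸ k ≥ k+1 of them, each b in
-- at most k+1 of them, and only if b ∈ ∇ p.
shadow-inequality : ∀ {N} k (p : Family N) → (∀ a → p a ≡ true → ones a ≡ k) →
  suc k + k ≤ N → # p ≤ # (∇ p)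
shadow-inequality {N} k p flat room = *-cancelʳ-≤ (# p) (# (∇ p)) (suc k) (begin
  # p * suc k                                ≡⟨ ∑-*ʳ (λ a → ind (p a)) (suc k) ⟨
  ∑ (λ a → ind (p a) * suc k)                ≤⟨ ∑-mono upward ⟩
  ∑ (λ a → # (λ b → p a ∧ a ⋖ b))            ≡⟨ ∑-swap (λ a b → ind (p a ∧ a ⋖ b)) ⟩
  ∑ (λ b → # (λ a → p a ∧ a ⋖ b))            ≤⟨ ∑-mono downward ⟩
  ∑ (λ b → ind (∇ p b) * suc k)              ≡⟨ ∑-*ʳ (λ b → ind (∇ p b)) (suc k) ⟩
  # (∇ p) * suc k                            ∎)
  where
  open ≤-Reasoning

  upward : ∀ a → ind (p a) * suc k ≤ # (λ b → p a ∧ a ⋖ b)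
  upward a with p a in pa
  ... | false = z≤n
  ... | true = begin
    1 * suc k        ≡⟨ *-identityˡ (suc k) ⟩
    suc k            ≤⟨ +-cancelʳ-≤ k (suc k) (# (a ⋖_)) (≤-trans room (≤-reflexive N≡)) ⟩
    # (a ⋖_)         ∎
    where
    N≡ : N ≡ # (a ⋖_) + k
    N≡ = trans (sym (up-degree a)) (cong (# (a ⋖_) +_) (flat a pa))

  downward : ∀ b → # (λ a → p a ∧ a ⋖ b) ≤ ind (∇ p b) * suc k
  downward b with ∇ p b in ∇pb
  ... | false = ≤-reflexive (#-empty (λ a → p a ∧ a ⋖ b) not-covered)
    where
    not-covered : ∀ a → (p a ∧ a ⋖ b) ≡ false
    not-covered a with p a in pa | a ⋖ b in a⋖b
    ... | false | _ = refl
    ... | true | false = refl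
    ... | true | true = contradiction (trans (sym ∇pb) (∇-intro p pa a⋖b)) λ ()
  ... | true with ∇-witness p ∇pb
  ...   | a₀ , pa₀ , a₀⋖b = begin
    # (λ a → p a ∧ a ⋖ b) ≤⟨ #-mono (λ a → ∧-conicalʳ (p a) (a ⋖ b)) ⟩
    # (_⋖ b)              ≡⟨ down-degree b ⟩
    ones b                ≡⟨ ⋖-ones a₀ b a₀⋖b ⟩
    suc (ones a₀)         ≡⟨ cong suc (flat a₀ pa₀) ⟩
    suc k                 ≡⟨ *-identityˡ (suc k) ⟨
    1 * suc k             ∎

Antichain : ∀ {N} → Family N → Set
Antichain p = ∀ a b → p a ≡ true → p b ≡ true → a ⊑ b → a ≡ b

Antichain? : ∀ {N} (p : Family N) → Dec (Antichain p)
Antichain? p = ∀-cube? λ a → ∀-cube? λ b →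
  (p a ≟ᵇ true) →-dec (p b ≟ᵇ true) →-dec (a ⊑? b) →-dec (a ≟ᵗ b)

module Lift {N} (k : ℕ) (p : Family N) where

  level : Family N
  level a = p a ∧ does (ones a ≟ k)

  other : Family N
  other a = p a ∧ not (does (ones a ≟ k))

  lift : Family N
  lift a = other a ∨ ∇ level a

  level-member : ∀ a → level a ≡ true → p a ≡ true × ones a ≡ k
  level-member a e = ∧-conicalˡ (p a) _ e , does-true (ones a ≟ k) (∧-conicalʳ (p a) _ e)

  other-member : ∀ a → other a ≡ true → p a ≡ true × ones a ≢ k
  other-member a e =
    ∧-conicalˡ (p a) _ e , does-false (ones a ≟ k) (not-injective (∧-conicalʳ (p a) _ e))

  shadow-member : ∀ a → ∇ level a ≡ true → ∃[ f ] p f ≡ true × ones f ≡ k × f ⊑ a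
  shadow-member a e with ∇-witness level e
  ... | f , level-f , f⋖a = f , proj₁ (level-member f level-f) , proj₂ (level-member f level-f) , ⋖-⊑ f a f⋖a

  shadow-weight : ∀ a → ∇ level a ≡ true → ones a ≡ suc k
  shadow-weight a e with ∇-witness level e
  ... | f , level-f , f⋖a = trans (⋖-ones f a f⋖a) (cong suc (proj₂ (level-member f level-f)))

  lift-keeps : ∀ a → p a ≡ true → ones a ≢ k → lift a ≡ true
  lift-keeps a pa wa≢k rewrite pa | dec-false (ones a ≟ k) wa≢k = refl

  module _ (anti : Antichain p) (high : ∀ a → p a ≡ true → k ≤ ones a) where

    shadow-below : ∀ a b → ∇ level a ≡ true → p b ≡ true → a ⊑ b → ones b ≡ k
    shadow-below a b e pb a⊑b with shadow-member a e
    ... | f , pf , wf , f⊑a = trans (cong ones (sym (anti f b pf pb (⊑-trans f⊑a a⊑b)))) wf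

    lift-high : ∀ a → lift a ≡ true → suc k ≤ ones a
    lift-high a e with ∨-split (other a) _ e
    ... | inj₁ o = let pa , wa≢k = other-member a o in ≤∧≢⇒< (high a pa) (wa≢k ∘ sym)
    ... | inj₂ s = ≤-reflexive (sym (shadow-weight a s))

    -- Two members of p stay incomparable; a shadow member is never below a member of p;
    -- and a member lying below a shadow member b has weight ≥ k+1 = ones b, so equals b.
    lift-antichain : Antichain lift
    lift-antichain a b ea eb a⊑b with ∨-split (other a) _ ea | ∨-split (other b) _ eb
    ... | inj₁ oa | inj₁ ob = anti a b (proj₁ (other-member a oa)) (proj₁ (other-member b ob)) a⊑b
    ... | inj₂ sa | inj₁ ob =
      contradiction (shadow-below a b sa (proj₁ (other-member b ob)) a⊑b) (proj₂ (other-member b ob))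
    ... | _ | inj₂ sb = ⊑-ones-eq a⊑b (begin
      ones b  ≡⟨ shadow-weight b sb ⟩
      suc k   ≤⟨ lift-high a ea ⟩
      ones a  ∎)
      where open ≤-Reasoning

    lift-size : suc k + k ≤ N → # p ≤ # lift
    lift-size room = begin
      # p                     ≡⟨ #-split p (λ a → does (ones a ≟ k)) ⟩
      # other + # level       ≤⟨ +-monoʳ-≤ (# other) (shadow-inequality k level (λ a → proj₂ ∘ level-member a) room) ⟩
      # other + # (∇ level)   ≡⟨ #-∨ other (∇ level) disjoint ⟨
      # lift                  ∎
      where
      open ≤-Reasoning
      disjoint : ∀ a → other a ≡ true → ∇ level a ≡ true → ⊥
      disjoint a oa sa = let pa , wa≢k = other-member a oa in
        wa≢k (shadow-below a a sa pa (⊑-refl a))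

record Raised {N} (p : Family N) (j : ℕ) : Set where
  field
    family : Family N
    antichain : Antichain family
    high : ∀ a → family a ≡ true → j ≤ ones a
    larger : # p ≤ # family
    keeps : ∀ a → p a ≡ true → j ≤ ones a → family a ≡ true

raise : ∀ {N} (p : Family N) → Antichain p → ∀ j → j + j ≤ suc N → Raised p j
raise p anti zero _ = record
  { family = p ; antichain = anti ; high = λ _ _ → z≤n ; larger = ≤-refl ; keeps = λ _ pa _ → pa }
raise {N} p anti (suc j) room = record
  { family = lift
  ; antichain = lift-antichain antichain high
  ; high = lift-high antichain high
  ; larger = ≤-trans larger (lift-size antichain high room′)
  ; keeps = λ a pa j<wa →
      lift-keeps a (keeps a pa (<⇒≤ j<wa)) (λ wa≡j → <⇒≢ j<wa (sym wa≡j))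
  }
  where
  room″ : j + j ≤ suc N
  room″ = ≤-trans (+-mono-≤ (n≤1+n j) (n≤1+n j)) room

  room′ : suc j + j ≤ N
  room′ = s≤s⁻¹ (subst (_≤ suc N) (+-suc (suc j) j) room)

  open Raised (raise p anti j room″)
  open Lift j family

glue : ∀ {N} → Family N → Family N → Family (suc N)
glue p q (false ∷ a) = p a
glue p q (true ∷ a) = q a

-- All families on the cube, each one up to pointwise equality.
families : ∀ N → List (Family N)
families zero = (λ _ → false) ∷ (λ _ → true) ∷ []
families (suc N) = cartesianProductWith glue (families N) (families N)

families-complete : ∀ {N} (p : Family N) → ∃[ q ] q ∈ families N × (∀ a → p a ≡ q a)
families-complete {zero} p with p [] in p[]
... | false = (λ _ → false) , here refl , λ { [] → p[] }
... | true = (λ _ → true) , there (here refl) , λ { [] → p[] }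
families-complete {suc N} p with families-complete (face false p) | families-complete (face true p)
... | q₀ , q₀∈ , p₀≗q₀ | q₁ , q₁∈ , p₁≗q₁ =
  glue q₀ q₁ , ∈-cartesianProductWith⁺ glue q₀∈ q₁∈ , λ { (false ∷ a) → p₀≗q₀ a ; (true ∷ a) → p₁≗q₁ a }

-- Among the antichains containing a given tuple x there is one of maximum size: take the
-- largest one in the finite list of all families (the singleton {x} shows there is one).
maximum-antichain : ∀ {N} (x : Tuple N) →
  ∃[ m ] Antichain m × m x ≡ true × (∀ p → Antichain p → p x ≡ true → # p ≤ # m)
maximum-antichain {N} x = m , proj₁ m-ok , proj₂ m-ok , maximal
  where
  Ok : Family N → Set
  Ok p = Antichain p × p x ≡ true

  ok? : ∀ p → Dec (Ok p)
  ok? p = Antichain? p ×-dec (p x ≟ᵇ true)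

  singleton : Family N
  singleton a = does (a ≟ᵗ x)

  singleton-ok : Ok singleton
  singleton-ok = (λ a b a≡x b≡x _ → trans (does-true (a ≟ᵗ x) a≡x) (sym (does-true (b ≟ᵗ x) b≡x)))
               , dec-true (x ≟ᵗ x) refl

  m : Family N
  m = argmax # singleton (filter ok? (families N))

  m-ok : Ok m
  m-ok = argmax-all # singleton-ok (all-filter ok? (families N))

  maximal : ∀ p → Antichain p → p x ≡ true → # p ≤ # m
  maximal p anti px with families-complete p
  ... | q , q∈ , p≗q = begin
    # p ≡⟨ #-cong p≗q ⟩
    # q ≤⟨ All.lookup (f[xs]≤f[argmax] {f = #} singleton (filter ok? (families N))) (∈-filter⁺ ok? q∈ q-ok) ⟩
    # m ∎
    where
    open ≤-Reasoning
    q-ok : Ok q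
    q-ok = (λ a b qa qb → anti a b (trans (p≗q a) qa) (trans (p≗q b) qb)) , trans (sym (p≗q x)) px

members : ∀ {N} → Family N → List (Tuple N)
members {zero} p = if p [] then [] ∷ [] else []
members {suc N} p = map (false ∷_) (members (face false p)) ++ map (true ∷_) (members (face true p))

∈-members⁺ : ∀ {N} (p : Family N) {a} → p a ≡ true → a ∈ members p
∈-members⁺ {zero} p {[]} pa rewrite pa = here refl
∈-members⁺ {suc N} p {false ∷ a} pa = ∈-++⁺ˡ (∈-map⁺ (false ∷_) (∈-members⁺ (face false p) pa))
∈-members⁺ {suc N} p {true ∷ a} pa =
  ∈-++⁺ʳ (map (false ∷_) (members (face false p))) (∈-map⁺ (true ∷_) (∈-members⁺ (face true p) pa))

∈-members⁻ : ∀ {N} (p : Family N) {a} → a ∈ members p → p a ≡ true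
∈-members⁻ {zero} p {[]} a∈ with p [] | a∈
... | true | _ = refl
... | false | ()
∈-members⁻ {suc N} p a∈ with ∈-++⁻ (map (false ∷_) (members (face false p))) a∈
... | inj₁ a∈₀ with ∈-map⁻ (false ∷_) a∈₀
...   | b , b∈ , refl = ∈-members⁻ (face false p) b∈
∈-members⁻ {suc N} p a∈ | inj₂ a∈₁ with ∈-map⁻ (true ∷_) a∈₁
...   | b , b∈ , refl = ∈-members⁻ (face true p) b∈

members-unique : ∀ {N} (p : Family N) → Unique (members p)
members-unique {zero} p with p []
... | true = All.[] AllPairs.∷ AllPairs.[]
... | false = AllPairs.[]
members-unique {suc N} p = Unique.++⁺ (Unique.map⁺ ∷-injectiveʳ (members-unique (face false p)))
                                      (Unique.map⁺ ∷-injectiveʳ (members-unique (face true p)))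
                                      faces-disjoint
  where
  faces-disjoint : ∀ {v} → ¬ (v ∈ map (false ∷_) (members (face false p)) × v ∈ map (true ∷_) (members (face true p)))
  faces-disjoint (v∈₀ , v∈₁) with ∈-map⁻ (false ∷_) v∈₀ | ∈-map⁻ (true ∷_) v∈₁
  ... | _ , _ , refl | _ , _ , ()

length-members : ∀ {N} (p : Family N) → length (members p) ≡ # p
length-members {zero} p with p []
... | true = refl
... | false = refl
length-members {suc N} p = begin
  length (map (false ∷_) (members (face false p)) ++ map (true ∷_) (members (face true p)))
    ≡⟨ length-++ (map (false ∷_) (members (face false p))) ⟩
  length (map (false ∷_) (members (face false p))) + length (map (true ∷_) (members (face true p)))
    ≡⟨ cong₂ _+_ (length-map (false ∷_) (members (face false p))) (length-map (true ∷_) (members (face true p))) ⟩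
  length (members (face false p)) + length (members (face true p))
    ≡⟨ cong₂ _+_ (length-members (face false p)) (length-members (face true p)) ⟩
  # p ∎
  where open ≡-Reasoning

module Membership {N} = DecMembership (_≟ᵗ_ {N})
open Membership using (_∈?_)

listed : ∀ {N} → List (Tuple N) → Family N
listed U a = does (a ∈? U)

#-listed : ∀ {N} {U : List (Tuple N)} → Unique U → # (listed U) ≡ length U
#-listed {N} {[]} _ = #-∅ N
#-listed {N} {u ∷ U} (u∉U AllPairs.∷ unique) = begin
  # (listed (u ∷ U))                          ≡⟨ #-∨ (λ a → does (a ≟ᵗ u)) (listed U) disjoint ⟩
  # (λ a → does (a ≟ᵗ u)) + # (listed U)      ≡⟨ cong₂ _+_ (#-singleton u) (#-listed unique) ⟩
  suc (length U)                              ∎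
  where
  open ≡-Reasoning
  disjoint : ∀ a → does (a ≟ᵗ u) ≡ true → listed U a ≡ true → ⊥
  disjoint a a≡u a∈U = All.lookup u∉U (does-true (a ∈? U) a∈U) (sym (does-true (a ≟ᵗ u) a≡u))

pair-family : ∀ {n} → List (Tuple n) → List (Tuple n) → Family (suc n)
pair-family U′ U″ = glue (listed U″) (listed U′)

module _ {n} {g : Tuple n} {U′ U″ : List (Tuple n)} (inA : InA g U′ U″) where
  private
    anti′ = proj₂ (proj₁ inA)
    anti″ = proj₂ (proj₁ (proj₂ inA))
    g∈U′ = proj₁ (proj₂ (proj₂ inA))
    cross = proj₂ (proj₂ (proj₂ inA))

  pair-antichain : Antichain (pair-family U′ U″)
  pair-antichain (false ∷ a) (false ∷ b) a∈ b∈ (stay .false a⊑b) =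
    cong (false ∷_) (anti″ a b (does-true (a ∈? U″) a∈) (does-true (b ∈? U″) b∈) (⊑⇒≼ a⊑b))
  pair-antichain (true ∷ a) (true ∷ b) a∈ b∈ (stay .true a⊑b) =
    cong (true ∷_) (anti′ a b (does-true (a ∈? U′) a∈) (does-true (b ∈? U′) b∈) (⊑⇒≼ a⊑b))
  pair-antichain (false ∷ a) (true ∷ b) a∈ b∈ (rise a⊑b) =
    contradiction (⊑⇒≼ a⊑b) (cross b a (does-true (b ∈? U′) b∈) (does-true (a ∈? U″) a∈))

  pair-contains : pair-family U′ U″ (true ∷ g) ≡ true
  pair-contains = dec-true (g ∈? U′) g∈U′

  pair-size : card U′ U″ ≡ # (pair-family U′ U″)
  pair-size = trans (+-comm (length U′) (length U″))
                    (sym (cong₂ _+_ (#-listed (proj₁ (proj₁ (proj₂ inA)))) (#-listed (proj₁ (proj₁ inA)))))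

split-pair : ∀ {n} {g : Tuple n} (q : Family (suc n)) → Antichain q → q (true ∷ g) ≡ true →
  InA g (members (face true q)) (members (face false q))
split-pair q anti qg = face-antichain true , face-antichain false , ∈-members⁺ (face true q) qg , cross
  where
  face-antichain : ∀ x → IsAntichain (members (face x q))
  face-antichain x = members-unique (face x q) , λ α β α∈ β∈ α≼β →
    ∷-injectiveʳ (anti (x ∷ α) (x ∷ β) (∈-members⁻ (face x q) α∈) (∈-members⁻ (face x q) β∈)
                       (stay x (≼⇒⊑ α β α≼β)))

  cross : ∀ α′ α″ → α′ ∈ members (face true q) → α″ ∈ members (face false q) → ¬ (α″ ≼ α′)
  cross α′ α″ α′∈ α″∈ α″≼α′ with anti (false ∷ α″) (true ∷ α′)
    (∈-members⁻ (face false q) α″∈) (∈-members⁻ (face true q) α′∈) (rise (≼⇒⊑ α″ α′ α″≼α′))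
  ... | ()

split-size : ∀ {n} (q : Family (suc n)) → card (members (face true q)) (members (face false q)) ≡ # q
split-size q = trans (cong₂ _+_ (length-members (face true q)) (length-members (face false q)))
                     (+-comm (# (face true q)) (# (face false q)))

ones-threshold : ∀ n m (f : Fin n → Bool) →
  (∀ i → f i ≡ true → m ≤ toℕ i) → (∀ i → m ≤ toℕ i → f i ≡ true) → ones (tabulate f) ≡ n ∸ m
ones-threshold zero m f _ _ = sym (0∸n≡0 m)
ones-threshold (suc n) zero f _ above rewrite above fzero z≤n =
  cong suc (ones-threshold n zero (f ∘ fsuc) (λ _ _ → z≤n) (λ i _ → above (fsuc i) z≤n))
ones-threshold (suc n) (suc m) f below above with f fzero in f0
... | true = contradiction (below fzero f0) λ ()
... | false = ones-threshold n m (f ∘ fsuc) (λ i e → s≤s⁻¹ (below (fsuc i) e)) (λ i le → above (fsuc i) (s≤s le))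

ones-gamma : ∀ n s → s ≤ n → ones (gamma n s) ≡ s
ones-gamma n s s≤n = trans (ones-threshold n (n ∸ s) _ (λ i → does-true (n ∸ s ≤? toℕ i))
                                                      (λ i → dec-true (n ∸ s ≤? toℕ i)))
                           (m∸[m∸n]≡n s≤n)

lemma6 : (n s : ℕ) → 1 ≤ n → n < 2 * s → s ≤ n →
    Σ (List (Tuple n)) λ T′ → Σ (List (Tuple n)) λ T″ →
      InA (gamma n s) T′ T″ ×
      (∀ U′ U″ → InA (gamma n s) U′ U″ → card U′ U″ ≤ card T′ T″) ×
      (∀ α → α ∈ T′ → n / 2 ≤ ones α) ×
      (∀ α → α ∈ T″ → n / 2 ≤ ones α)
lemma6 n s _ n<2s s≤n with maximum-antichain (true ∷ gamma n s)
... | m , m-anti , m-x , m-max =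
  members (face true family) , members (face false family) ,
  split-pair family antichain x-kept , maximal , weight′ , weight″
  where
  t = n / 2

  t≤s : t ≤ s
  t≤s = <⇒≤ (m<n*o⇒m/o<n (subst (n <_) (*-comm 2 s) n<2s))

  2t≤n : t + t ≤ n
  2t≤n = subst (_≤ n) (trans (*-comm t 2) (cong (t +_) (+-identityʳ t))) (m/n*n≤m n 2)

  -- Raise m to the levels ≥ t+1 of {0,1}^(n+1); x = 1γ̃_s has weight s+1 and is kept.
  open Raised (raise m m-anti (suc t) (s≤s (subst (_≤ suc n) (sym (+-suc t t)) (s≤s 2t≤n))))

  x-kept : family (true ∷ gamma n s) ≡ true
  x-kept = keeps (true ∷ gamma n s) m-x (s≤s (subst (t ≤_) (sym (ones-gamma n s s≤n)) t≤s))

  maximal : ∀ U′ U″ → InA (gamma n s) U′ U″ →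
    card U′ U″ ≤ card (members (face true family)) (members (face false family))
  maximal U′ U″ inA = begin
    card U′ U″                 ≡⟨ pair-size inA ⟩
    # (pair-family U′ U″)      ≤⟨ m-max (pair-family U′ U″) (pair-antichain inA) (pair-contains inA) ⟩
    # m                        ≤⟨ larger ⟩
    # family                   ≡⟨ split-size family ⟨
    card (members (face true family)) (members (face false family)) ∎
    where open ≤-Reasoning

  weight′ : ∀ α → α ∈ members (face true family) → t ≤ ones α
  weight′ α α∈ = s≤s⁻¹ (high (true ∷ α) (∈-members⁻ (face true family) α∈))

  weight″ : ∀ α → α ∈ members (face false family) → t ≤ ones α
  weight″ α α∈ = ≤-trans (n≤1+n t) (high (false ∷ α) (∈-members⁻ (face false family) α∈))
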